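{- Let $n\ge1$ and let $r$ be the length of the principal prefix of $\beta(n)$. The map $c\mapsto\mathsf{s}(c)=(s_1(c),\dots,s_r(c))$ is a poset embedding of $\mathcal{D}(n)$ into $\mathbb{N}^r$ (with componentwise order), i.e. $c\le d$ in $\mathcal{D}(n)$ if and only if $\mathsf{s}(c)\le\mathsf{s}(d)$ componentwise.
   Context: $\beta(n)=b_1\cdots b_k$ is the binary expansion ($b_1=1$ most significant). Its principal prefix is $b_1\cdots b_r$, where $b_{r+1}$ is the rightmost $0$ of $\beta(n)$ ($r=0$ if there is no $0$). A hyperbinary expansion of $n$ is a word $d_1\cdots d_k$ of length $k$ over $\{0,1,2\}$ with $\sum_i d_i2^{k-i}=n$, corresponding to the hyperbinary partition (parts powers of $2$, each at most twice) in which $2^{k-i}$ has multiplicity $d_i$. $\mathcal{D}(n)$ is the set of these, ordered by transporting refinement of partitions ($\mu\le\lambda$ if the parts of $\lambda$ can be subdivided to produce the parts of $\mu$). $s_j(c)=\sum_{i=1}^j c_i2^{j-i}$. -}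

module Defs where

open import Data.Nat using (ℕ; zero; suc; _+_; _*_; _∸_; _^_; _≤_; _≡ᵇ_)
open import Data.Nat.DivMod using (_/_; _%_)
open import Data.Nat.Logarithm using (⌊log₂_⌋)
open import Data.Bool using (Bool; true; false)
open import Data.Maybe using (Maybe; just; nothing; maybe)
open import Data.List using (List; []; _∷_; length; applyUpTo; replicate; _++_; concat; take; foldl)
open import Data.Nat.ListAction using (sum)
open import Data.List.Relation.Unary.All using (All)
open import Data.List.Relation.Binary.Pointwise using (Pointwise)
open import Data.List.Relation.Binary.Permutation.Propositional using (_↭_)
open import Data.Product using (Σ; _×_)
open import Relation.Binary.PropositionalEquality using (_≡_)

bitLength : ℕ → ℕ
bitLength n = suc ⌊log₂ n ⌋

-- β(n) = b₁ ⋯ b_k, most significant first; b_{i+1} = ⌊n / 2^(k-1-i)⌋ mod 2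
-- ⌊n / 2^m⌋
shiftR : ℕ → ℕ → ℕ
shiftR n zero = n
shiftR n (suc m) = shiftR n m / 2

β : ℕ → List Bool
β n = applyUpTo (λ i → shiftR n (bitLength n ∸ suc i) % 2 ≡ᵇ 1) (bitLength n)

rightmostZero : List Bool → Maybe ℕ
rightmostZero [] = nothing
rightmostZero (b ∷ bs) with rightmostZero bs
... | just i  = just (suc i)
... | nothing with b
...   | true  = nothing
...   | false = just 0

-- length r of the principal prefix: if b_{r+1} is the rightmost 0, then its
-- 0-based index is r; r = 0 if there is no 0.
principalLength : ℕ → ℕ
principalLength n = maybe (λ i → i) 0 (rightmostZero (β n))

value : List ℕ → ℕ
value = foldl (λ acc d → 2 * acc + d) 0

s : ℕ → List ℕ → ℕ
s j c = value (take j c)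

IsHyperbinary : ℕ → List ℕ → Set
IsHyperbinary n c = (length c ≡ bitLength n) × All (λ d → d ≤ 2) c × (value c ≡ n)

parts : List ℕ → List ℕ
parts [] = []
parts (d ∷ ds) = replicate d (2 ^ length ds) ++ parts ds

-- μ ≤ λ (refinement): the parts of λ can be subdivided to produce the parts of μ,
-- i.e. there are lists ls, one per part of λ summing to that part, whose
-- concatenation is (a rearrangement of) μ.
Refines : List ℕ → List ℕ → Set
Refines μ lam = Σ (List (List ℕ)) (λ ls → Pointwise (λ l p → sum l ≡ p) ls lam × (concat ls ↭ μ))

_≤ᴰ_ : List ℕ → List ℕ → Set
c ≤ᴰ d = Refines (parts c) (parts d)

{-# OPTIONS --safe #-}

-- Refinement can only lower, for every threshold t, the total of the parts that are at least t,
-- because x ↦ (x if t ≤ x else 0) is superadditive; for a word c of length j + m and t = 2^m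
-- that total is s_j(c)·2^m, so c ≤ d forces s(c) ≤ s(d). Conversely, if s(c) ≤ s(d)
-- everywhere then c₁ ≤ d₁, and halving d₁ − c₁ of the largest parts of d gives a refinement of d
-- with first digit c₁, to whose tail induction applies. Only j ≤ r needs to be assumed: the bits
-- of n after position r are all 1, and s_{i+1} = 2 s_i + c_{i+1} with c_{i+1} ≤ 2 determines s_i
-- when s_{i+1} is odd, so for j > r every expansion has s_j = ⌊n / 2^(k−j)⌋.

module Submission where

open import Defs
open import Data.Bool using (Bool; true; false; T)
open import Data.Fin using (toℕ; fromℕ<)
open import Data.Fin.Properties using (toℕ-fromℕ<)
open import Data.List
  using (List; []; _∷_; _∷ʳ_; length; lookup; applyUpTo; replicate; _++_; concat; take; map; foldl)
open import Data.List.Properties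
  using (take-all; take-suc; foldl-∷ʳ; length-take; concat-concat; concat-++; map-++; ++-assoc)
open import Data.List.Membership.Propositional.Properties using (∈-lookup)
import Data.List.Relation.Unary.All as All
open import Data.List.Relation.Binary.Pointwise as Pointwise using (Pointwise; []; _∷_)
open import Data.List.Relation.Binary.Permutation.Propositional as ↭
  using (_↭_; ↭-sym; ↭-trans; ↭-reflexive)
open import Data.List.Relation.Binary.Permutation.Propositional.Properties as ↭ₚ using (map⁺)
open import Data.List.Relation.Binary.BagAndSetEquality using (↭⇒∼bag; ∼bag⇒↭; concat-cong)
open import Data.Maybe using (just; nothing; maybe)
open import Data.Maybe.Relation.Unary.All as Maybe using (just; nothing)
open import Data.Nat
  using (ℕ; zero; suc; _+_; _*_; _∸_; _^_; _≤_; _<_; z≤n; s≤s; z<s; _≤?_; _≡ᵇ_; _%_; _/_; _⊓_)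
open import Data.Nat.Properties
open import Data.Nat.DivMod using (m≡m%n+[m/n]*n)
open import Data.Nat.ListAction using (sum)
open import Data.Nat.ListAction.Properties using (sum-++; sum-↭)
open import Data.Nat.Tactic.RingSolver using (solve-∀)
open import Data.Product using (∃-syntax; ∃₂; _×_; _,_)
open import Data.Empty using (⊥-elim)
open import Data.Unit using (tt)
open import Function using (_∘_)
open import Relation.Nullary using (yes; no)
open import Relation.Binary.PropositionalEquality
  using (_≡_; refl; sym; trans; cong; cong₂; subst; subst₂; module ≡-Reasoning)

module _ {A B : Set} {R : A → B → Set} where

  Pointwise-↭ʳ : ∀ {xs ys ys′} → Pointwise R xs ys → ys ↭ ys′ →
                 ∃[ xs′ ] xs ↭ xs′ × Pointwise R xs′ ys′
  Pointwise-↭ʳ rs ↭.refl = _ , ↭.refl , rs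
  Pointwise-↭ʳ (r ∷ rs) (↭.prep _ p) with Pointwise-↭ʳ rs p
  ... | _ , q , rs′ = _ , ↭.prep _ q , r ∷ rs′
  Pointwise-↭ʳ (r₁ ∷ r₂ ∷ rs) (↭.swap _ _ p) with Pointwise-↭ʳ rs p
  ... | _ , q , rs′ = _ , ↭.swap _ _ q , r₂ ∷ r₁ ∷ rs′
  Pointwise-↭ʳ rs (↭.trans p₁ p₂) with Pointwise-↭ʳ rs p₁
  ... | _ , q₁ , rs₁ with Pointwise-↭ʳ rs₁ p₂
  ... | _ , q₂ , rs₂ = _ , ↭.trans q₁ q₂ , rs₂

  Pointwise-++⁻ʳ : ∀ ys {zs xs} → Pointwise R xs (ys ++ zs) →
                   ∃₂ λ xs₁ xs₂ → xs ≡ xs₁ ++ xs₂ × Pointwise R xs₁ ys × Pointwise R xs₂ zs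
  Pointwise-++⁻ʳ []       rs       = [] , _ , refl , [] , rs
  Pointwise-++⁻ʳ (y ∷ ys) (r ∷ rs) with Pointwise-++⁻ʳ ys rs
  ... | _ , _ , refl , rs₁ , rs₂ = _ , _ , refl , r ∷ rs₁ , rs₂

  Pointwise-concat⁻ʳ : ∀ yss {xs} → Pointwise R xs (concat yss) →
                       ∃[ xss ] concat xss ≡ xs × Pointwise (Pointwise R) xss yss
  Pointwise-concat⁻ʳ []         [] = [] , refl , []
  Pointwise-concat⁻ʳ (ys ∷ yss) rs with Pointwise-++⁻ʳ ys rs
  ... | _ , _ , refl , rs₁ , rs₂ with Pointwise-concat⁻ʳ yss rs₂
  ... | _ , refl , rss = _ , refl , rs₁ ∷ rss

concat-↭ : {A : Set} {xss yss : List (List A)} → xss ↭ yss → concat xss ↭ concat yss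
concat-↭ p = ∼bag⇒↭ (concat-cong (↭⇒∼bag p))

replicate-+ : {A : Set} (m n : ℕ) (x : A) → replicate (m + n) x ≡ replicate m x ++ replicate n x
replicate-+ zero    n x = refl
replicate-+ (suc m) n x = cong (x ∷_) (replicate-+ m n x)

sum-map-++ : ∀ (f : ℕ → ℕ) xs ys → sum (map f (xs ++ ys)) ≡ sum (map f xs) + sum (map f ys)
sum-map-++ f xs ys = trans (cong sum (map-++ f xs ys)) (sum-++ (map f xs) (map f ys))

sum-map-replicate : ∀ (f : ℕ → ℕ) n x → sum (map f (replicate n x)) ≡ n * f x
sum-map-replicate f zero    x = refl
sum-map-replicate f (suc n) x = cong (f x +_) (sum-map-replicate f n x)

SumsTo : List ℕ → ℕ → Set
SumsTo l p = sum l ≡ p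

sum-concat : ∀ {ls ps} → Pointwise SumsTo ls ps → sum (concat ls) ≡ sum ps
sum-concat []                  = refl
sum-concat {l ∷ ls} (refl ∷ rs) = trans (sum-++ l (concat ls)) (cong (sum l +_) (sum-concat rs))

Refines-refl : ∀ xs → Refines xs xs
Refines-refl []       = [] , [] , ↭.refl
Refines-refl (x ∷ xs) with Refines-refl xs
... | ls , rs , p = (x ∷ []) ∷ ls , +-identityʳ x ∷ rs , ↭.prep x p

-- Reorder the pieces of ν to follow concat ls, then group them by the parts of ρ.
Refines-trans : ∀ {μ ν ρ} → Refines μ ν → Refines ν ρ → Refines μ ρ
Refines-trans (ms , ms≈ν , ms↭μ) (ls , ls≈ρ , ls↭ν) with Pointwise-↭ʳ ms≈ν (↭-sym ls↭ν)
... | _ , ms↭ms′ , ms′≈ls with Pointwise-concat⁻ʳ ls ms′≈ls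
... | gs , refl , gs≈ls =
  map concat gs , merge gs≈ls ls≈ρ ,
  ↭-trans (↭-reflexive (concat-concat gs)) (↭-trans (concat-↭ (↭-sym ms↭ms′)) ms↭μ)
  where
  merge : ∀ {gs ls ps} → Pointwise (Pointwise SumsTo) gs ls → Pointwise SumsTo ls ps →
          Pointwise SumsTo (map concat gs) ps
  merge []         []          = []
  merge (g ∷ gs≈ls) (refl ∷ rs) = sum-concat g ∷ merge gs≈ls rs

Refines-++ : ∀ {μ ν μ′ ν′} → Refines μ ν → Refines μ′ ν′ → Refines (μ ++ μ′) (ν ++ ν′)
Refines-++ (ls , rs , p) (ls′ , rs′ , p′) =
  ls ++ ls′ , Pointwise.++⁺ rs rs′ , ↭-trans (↭-reflexive (sym (concat-++ ls ls′))) (↭ₚ.++⁺ p p′)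

Refines-halve : ∀ e h → Refines (replicate (2 * e) h) (replicate e (2 * h))
Refines-halve zero    h = [] , [] , ↭.refl
Refines-halve (suc e) h with Refines-halve e h
... | ls , rs , p = subst (λ k → Refines (replicate k h) (replicate (suc e) (2 * h))) (sym (*-suc 2 e))
                      ((h ∷ h ∷ []) ∷ ls , refl ∷ rs , ↭.prep h (↭.prep h p))

value-acc : ∀ a ys → foldl (λ acc d → 2 * acc + d) a ys ≡ a * 2 ^ length ys + value ys
value-acc a []       = sym (trans (+-identityʳ (a * 1)) (*-identityʳ a))
value-acc a (y ∷ ys) = begin
  foldl _ (2 * a + y) ys
    ≡⟨ value-acc (2 * a + y) ys ⟩
  (2 * a + y) * 2 ^ length ys + value ys
    ≡⟨ regroup a y (2 ^ length ys) (value ys) ⟩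
  a * (2 * 2 ^ length ys) + (y * 2 ^ length ys + value ys)
    ≡⟨ cong (a * 2 ^ length (y ∷ ys) +_) (value-acc y ys) ⟨
  a * 2 ^ length (y ∷ ys) + value (y ∷ ys)
    ∎
  where
  open ≡-Reasoning
  regroup : ∀ a y p v → (2 * a + y) * p + v ≡ a * (2 * p) + (y * p + v)
  regroup = solve-∀

value-∷ : ∀ x ys → value (x ∷ ys) ≡ x * 2 ^ length ys + value ys
value-∷ = value-acc

value-∷ʳ : ∀ xs x → value (xs ∷ʳ x) ≡ 2 * value xs + x
value-∷ʳ xs x = foldl-∷ʳ _ 0 x xs

value-∷-≡ : ∀ x {u} (v : List ℕ) → length u ≡ length v → value (x ∷ u) ≡ x * 2 ^ length v + value u
value-∷-≡ x {u} v |u|≡|v| = trans (value-∷ x u) (cong (λ l → x * 2 ^ l + value u) |u|≡|v|)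

value-∷-cancelˡ-≤ : ∀ x u v → length u ≡ length v → value (x ∷ u) ≤ value (x ∷ v) → value u ≤ value v
value-∷-cancelˡ-≤ x u v |u|≡|v| le =
  +-cancelˡ-≤ (x * 2 ^ length v) _ _ (subst₂ _≤_ (value-∷-≡ x {u} v |u|≡|v|) (value-∷ x v) le)

value-∷-cancelˡ-≡ : ∀ x u v → length u ≡ length v → value (x ∷ u) ≡ value (x ∷ v) → value u ≡ value v
value-∷-cancelˡ-≡ x u v |u|≡|v| eq =
  +-cancelˡ-≡ (x * 2 ^ length v) _ _ (subst₂ _≡_ (value-∷-≡ x {u} v |u|≡|v|) (value-∷ x v) eq)

value-borrow : ∀ x e z v → value (x + e ∷ z ∷ v) ≡ value (x ∷ 2 * e + z ∷ v)
value-borrow x e z v = begin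
  value (x + e ∷ z ∷ v)                           ≡⟨ value-∷ (x + e) (z ∷ v) ⟩
  (x + e) * (2 * h) + value (z ∷ v)               ≡⟨ cong ((x + e) * (2 * h) +_) (value-∷ z v) ⟩
  (x + e) * (2 * h) + (z * h + value v)           ≡⟨ regroup x e z h (value v) ⟩
  x * (2 * h) + ((2 * e + z) * h + value v)       ≡⟨ cong (x * (2 * h) +_) (value-∷ (2 * e + z) v) ⟨
  x * (2 * h) + value (2 * e + z ∷ v)             ≡⟨ value-∷ x (2 * e + z ∷ v) ⟨
  value (x ∷ 2 * e + z ∷ v)                       ∎
  where
  open ≡-Reasoning
  h = 2 ^ length v
  regroup : ∀ x e z h v → (x + e) * (2 * h) + (z * h + v) ≡ x * (2 * h) + ((2 * e + z) * h + v)
  regroup = solve-∀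

length-take-≤ : ∀ {j} (c : List ℕ) → j ≤ length c → length (take j c) ≡ j
length-take-≤ {j} c j≤|c| = trans (length-take j c) (m≤n⇒m⊓n≡m j≤|c|)

length-take-cong : ∀ j {c d : List ℕ} → length c ≡ length d → length (take j c) ≡ length (take j d)
length-take-cong j {c} {d} |c|≡|d| =
  trans (length-take j c) (trans (cong (j ⊓_) |c|≡|d|) (sym (length-take j d)))

s-beyond-length : ∀ {j} c → length c ≤ j → s j c ≡ value c
s-beyond-length {j} c |c|≤j = cong value (take-all j c |c|≤j)

s-suc : ∀ c {i} (i<|c| : i < length c) → s (suc i) c ≡ 2 * s i c + lookup c (fromℕ< i<|c|)
s-suc c {i} i<|c| = subst (λ j → s (suc j) c ≡ 2 * s j c + lookup c o) (toℕ-fromℕ< i<|c|)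
  (trans (cong value (take-suc c o)) (value-∷ʳ (take (toℕ o) c) (lookup c o)))
  where o = fromℕ< i<|c|

-- Large parts under refinement

Superadditive : (ℕ → ℕ) → Set
Superadditive f = ∀ a b → f a + f b ≤ f (a + b)

superadditive-sum : ∀ {f} → Superadditive f → ∀ xs → sum (map f xs) ≤ f (sum xs)
superadditive-sum f-sup []           = z≤n
superadditive-sum {f} f-sup (x ∷ xs) =
  ≤-trans (+-monoʳ-≤ (f x) (superadditive-sum f-sup xs)) (f-sup x (sum xs))

Refines⇒sum-map-≤ : ∀ {f} → Superadditive f → ∀ {μ ν} → Refines μ ν → sum (map f μ) ≤ sum (map f ν)
Refines⇒sum-map-≤ {f} f-sup {μ} {ν} (ls , ls≈ν , ls↭μ) = begin
  sum (map f μ)            ≡⟨ sum-↭ (map⁺ f (↭-sym ls↭μ)) ⟩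
  sum (map f (concat ls))  ≤⟨ pieces ls≈ν ⟩
  sum (map f ν)            ∎
  where
  open ≤-Reasoning
  pieces : ∀ {ls ν} → Pointwise SumsTo ls ν → sum (map f (concat ls)) ≤ sum (map f ν)
  pieces []                  = z≤n
  pieces {l ∷ ls} {_ ∷ ν} (refl ∷ rs) = begin
    sum (map f (l ++ concat ls))                ≡⟨ sum-map-++ f l (concat ls) ⟩
    sum (map f l) + sum (map f (concat ls))     ≤⟨ +-mono-≤ (superadditive-sum f-sup l) (pieces rs) ⟩
    f (sum l) + sum (map f ν)                   ∎

zeroBelow : ℕ → ℕ → ℕ
zeroBelow t x with t ≤? x
... | yes _ = x
... | no  _ = 0

zeroBelow-≤ : ∀ t x → zeroBelow t x ≤ x
zeroBelow-≤ t x with t ≤? x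
... | yes _ = ≤-refl
... | no  _ = z≤n

zeroBelow-≥ : ∀ {t x} → t ≤ x → zeroBelow t x ≡ x
zeroBelow-≥ {t} {x} t≤x with t ≤? x
... | yes _   = refl
... | no  t≰x = ⊥-elim (t≰x t≤x)

zeroBelow-< : ∀ {t x} → x < t → zeroBelow t x ≡ 0
zeroBelow-< {t} {x} x<t with t ≤? x
... | yes t≤x = ⊥-elim (<⇒≱ x<t t≤x)
... | no  _   = refl

zeroBelow-superadditive : ∀ t → Superadditive (zeroBelow t)
zeroBelow-superadditive t a b with t ≤? a + b
... | yes _     = +-mono-≤ (zeroBelow-≤ t a) (zeroBelow-≤ t b)
... | no  t≰a+b = ≤-reflexive (cong₂ _+_ (zeroBelow-< (≤-<-trans (m≤m+n a b) a+b<t))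
                                          (zeroBelow-< (≤-<-trans (m≤n+m b a) a+b<t)))
  where a+b<t = ≰⇒> t≰a+b

sum-map-parts-∷ : ∀ f x c → sum (map f (parts (x ∷ c))) ≡ x * f (2 ^ length c) + sum (map f (parts c))
sum-map-parts-∷ f x c =
  trans (sum-map-++ f (replicate x _) (parts c)) (cong (_+ _) (sum-map-replicate f x _))

sum-zeroBelow-parts≡0 : ∀ m c → length c ≤ m → sum (map (zeroBelow (2 ^ m)) (parts c)) ≡ 0
sum-zeroBelow-parts≡0 m []      _     = refl
sum-zeroBelow-parts≡0 m (x ∷ c) |c|<m = begin
  sum (map f (parts (x ∷ c)))
    ≡⟨ sum-map-parts-∷ f x c ⟩
  x * f (2 ^ length c) + sum (map f (parts c))
    ≡⟨ cong₂ (λ a b → x * a + b) small (sum-zeroBelow-parts≡0 m c (<⇒≤ |c|<m)) ⟩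
  x * 0 + 0
    ≡⟨ cong (_+ 0) (*-zeroʳ x) ⟩
  0
    ∎
  where
  open ≡-Reasoning
  f = zeroBelow (2 ^ m)
  small : f (2 ^ length c) ≡ 0
  small = zeroBelow-< (^-monoʳ-< 2 (s≤s (s≤s z≤n)) |c|<m)

sum-zeroBelow-parts : ∀ j m c → length c ≡ j + m → sum (map (zeroBelow (2 ^ m)) (parts c)) ≡ s j c * 2 ^ m
sum-zeroBelow-parts zero    m c       |c|≡m   = sum-zeroBelow-parts≡0 m c (≤-reflexive |c|≡m)
sum-zeroBelow-parts (suc j) m (x ∷ c) |xc|≡1+j+m = begin
  sum (map f (parts (x ∷ c)))
    ≡⟨ sum-map-parts-∷ f x c ⟩
  x * f (2 ^ length c) + sum (map f (parts c))
    ≡⟨ cong₂ (λ a b → x * a + b) large (sum-zeroBelow-parts j m c |c|≡j+m) ⟩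
  x * 2 ^ length c + s j c * 2 ^ m
    ≡⟨ cong (λ l → x * l + s j c * 2 ^ m) (trans (cong (2 ^_) |c|≡j+m) (^-distribˡ-+-* 2 j m)) ⟩
  x * (2 ^ j * 2 ^ m) + s j c * 2 ^ m
    ≡⟨ regroup x (2 ^ j) (2 ^ m) (s j c) ⟩
  (x * 2 ^ j + s j c) * 2 ^ m
    ≡⟨ cong (λ l → (x * 2 ^ l + s j c) * 2 ^ m) (length-take-≤ c j≤|c|) ⟨
  (x * 2 ^ length (take j c) + s j c) * 2 ^ m
    ≡⟨ cong (_* 2 ^ m) (value-∷ x (take j c)) ⟨
  s (suc j) (x ∷ c) * 2 ^ m
    ∎
  where
  open ≡-Reasoning
  f = zeroBelow (2 ^ m)
  |c|≡j+m = suc-injective |xc|≡1+j+m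
  j≤|c| = subst (j ≤_) (sym |c|≡j+m) (m≤m+n j m)
  large : f (2 ^ length c) ≡ 2 ^ length c
  large = zeroBelow-≥ (^-monoʳ-≤ 2 (subst (m ≤_) (sym |c|≡j+m) (m≤n+m m j)))
  regroup : ∀ x p q t → x * (p * q) + t * q ≡ (x * p + t) * q
  regroup = solve-∀

≤ᴰ⇒s≤-≤length : ∀ c d → length c ≡ length d → c ≤ᴰ d → ∀ {j} → j ≤ length c → s j c ≤ s j d
≤ᴰ⇒s≤-≤length c d |c|≡|d| c≤d {j} j≤|c| =
  *-cancelʳ-≤ (s j c) (s j d) (2 ^ m) {{m^n≢0 2 m}} (begin
    s j c * 2 ^ m                             ≡⟨ sum-zeroBelow-parts j m c |c|≡j+m ⟨
    sum (map (zeroBelow (2 ^ m)) (parts c))   ≤⟨ Refines⇒sum-map-≤ (zeroBelow-superadditive (2 ^ m)) c≤d ⟩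
    sum (map (zeroBelow (2 ^ m)) (parts d))   ≡⟨ sum-zeroBelow-parts j m d (trans (sym |c|≡|d|) |c|≡j+m) ⟩
    s j d * 2 ^ m                             ∎)
  where
  open ≤-Reasoning
  m = length c ∸ j
  |c|≡j+m = sym (m+[n∸m]≡n j≤|c|)

≤ᴰ⇒s≤ : ∀ {c d} → length c ≡ length d → c ≤ᴰ d → ∀ j → s j c ≤ s j d
≤ᴰ⇒s≤ {c} {d} |c|≡|d| c≤d j with j ≤? length c
... | yes j≤|c| = ≤ᴰ⇒s≤-≤length c d |c|≡|d| c≤d j≤|c|
... | no  j≰|c| = begin
  s j c             ≡⟨ s-beyond-length c |c|≤j ⟩
  value c           ≡⟨ s-beyond-length c (≤-refl {length c}) ⟨
  s (length c) c    ≤⟨ ≤ᴰ⇒s≤-≤length c d |c|≡|d| c≤d ≤-refl ⟩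
  s (length c) d    ≡⟨ s-beyond-length d (≤-reflexive (sym |c|≡|d|)) ⟩
  value d           ≡⟨ s-beyond-length d (subst (_≤ j) |c|≡|d| |c|≤j) ⟨
  s j d             ∎
  where
  open ≤-Reasoning
  |c|≤j = <⇒≤ (≰⇒> j≰|c|)

-- Borrowing

≤ᴰ-∷ : ∀ x u v → length u ≡ length v → u ≤ᴰ v → (x ∷ u) ≤ᴰ (x ∷ v)
≤ᴰ-∷ x u v |u|≡|v| u≤v rewrite |u|≡|v| = Refines-++ (Refines-refl (replicate x _)) u≤v

≤ᴰ-borrow : ∀ x e z v → (x ∷ 2 * e + z ∷ v) ≤ᴰ (x + e ∷ z ∷ v)
≤ᴰ-borrow x e z v = subst₂ Refines source target
  (Refines-++ (Refines-refl (replicate x (2 * h)))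
              (Refines-++ (Refines-halve e h) (Refines-refl (replicate z h ++ parts v))))
  where
  h = 2 ^ length v
  source : replicate x (2 * h) ++ (replicate (2 * e) h ++ (replicate z h ++ parts v))
         ≡ parts (x ∷ 2 * e + z ∷ v)
  source = cong (replicate x (2 * h) ++_)
    (trans (sym (++-assoc (replicate (2 * e) h) _ _)) (cong (_++ parts v) (sym (replicate-+ (2 * e) z h))))
  target : replicate x (2 * h) ++ (replicate e (2 * h) ++ (replicate z h ++ parts v))
         ≡ parts (x + e ∷ z ∷ v)
  target = trans (sym (++-assoc (replicate x (2 * h)) _ _)) (cong (_++ _) (sym (replicate-+ x e (2 * h))))

s≤⇒≤ᴰ : ∀ c d → length c ≡ length d → (∀ j → s j c ≤ s j d) → value c ≡ value d → c ≤ᴰ d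
s≤⇒≤ᴰ []           []           _       _  _    = Refines-refl []
s≤⇒≤ᴰ (x ∷ [])     (y ∷ [])     _       _  refl = Refines-refl (parts (x ∷ []))
s≤⇒≤ᴰ (x ∷ w ∷ c) (y ∷ z ∷ d) |xwc|≡|yzd| s≤ v≡ =
  subst (λ y → (x ∷ w ∷ c) ≤ᴰ (y ∷ z ∷ d)) x+e≡y
    (Refines-trans {parts (x ∷ w ∷ c)} {parts (x ∷ d′)}
      (≤ᴰ-∷ x (w ∷ c) d′ |wc|≡|d′| (s≤⇒≤ᴰ (w ∷ c) d′ |wc|≡|d′| s≤′ v≡′))
      (≤ᴰ-borrow x e z d))
  where
  e = y ∸ x
  x+e≡y : x + e ≡ y
  x+e≡y = m+[n∸m]≡n (s≤ 1)
  borrowed : ∀ v → value (y ∷ z ∷ v) ≡ value (x ∷ 2 * e + z ∷ v)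
  borrowed v = trans (cong (λ y → value (y ∷ z ∷ v)) (sym x+e≡y)) (value-borrow x e z v)
  d′ = 2 * e + z ∷ d
  |c|≡|d| = suc-injective (suc-injective |xwc|≡|yzd|)
  |wc|≡|d′| = cong suc |c|≡|d|
  s≤′ : ∀ j → s j (w ∷ c) ≤ s j d′
  s≤′ zero    = z≤n
  s≤′ (suc j) = value-∷-cancelˡ-≤ x (w ∷ take j c) (2 * e + z ∷ take j d)
    (cong suc (length-take-cong j |c|≡|d|)) (subst (_ ≤_) (borrowed (take j d)) (s≤ (suc (suc j))))
  v≡′ : value (w ∷ c) ≡ value d′
  v≡′ = value-∷-cancelˡ-≡ x (w ∷ c) d′ |wc|≡|d′| (trans v≡ (borrowed d))

-- Prefix sums beyond the principal prefix

head-after-rightmostZero : ∀ b bs → Maybe.All (_< 0) (rightmostZero (b ∷ bs)) → b ≡ true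
head-after-rightmostZero b     bs after     with rightmostZero bs
head-after-rightmostZero true  bs nothing   | nothing = refl
head-after-rightmostZero false bs (just ()) | nothing
head-after-rightmostZero b     bs (just ()) | just _

tail-after-rightmostZero : ∀ b bs {i} → Maybe.All (_< suc i) (rightmostZero (b ∷ bs)) →
  Maybe.All (_< i) (rightmostZero bs)
tail-after-rightmostZero b bs after            with rightmostZero bs
tail-after-rightmostZero b bs (just (s≤s r<i)) | just _  = just r<i
tail-after-rightmostZero b bs _                | nothing = nothing

applyUpTo-after-rightmostZero : ∀ k (g : ℕ → Bool) {i} → i < k →
  Maybe.All (_< i) (rightmostZero (applyUpTo g k)) → g i ≡ true
applyUpTo-after-rightmostZero (suc k) g {zero}  _         after =
  head-after-rightmostZero (g 0) (applyUpTo (g ∘ suc) k) after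
applyUpTo-after-rightmostZero (suc k) g {suc i} (s≤s i<k) after =
  applyUpTo-after-rightmostZero k (g ∘ suc) i<k (tail-after-rightmostZero (g 0) (applyUpTo (g ∘ suc) k) after)

odd-shiftR-after-principalPrefix : ∀ n {i m} → principalLength n < i → i + suc m ≡ bitLength n →
  shiftR n m % 2 ≡ 1
odd-shiftR-after-principalPrefix n {i} {m} r<i i+1+m≡k =
  subst (λ l → shiftR n l % 2 ≡ 1) k∸1+i≡m (≡ᵇ⇒≡ _ 1 (subst T (sym bit-i) tt))
  where
  k = bitLength n
  after : ∀ mr → maybe (λ i → i) 0 mr < i → Maybe.All (_< i) mr
  after (just r) r<i = just r<i
  after nothing  _   = nothing
  bit-i = applyUpTo-after-rightmostZero k (λ i → shiftR n (k ∸ suc i) % 2 ≡ᵇ 1)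
            (subst (i <_) i+1+m≡k (m<m+n i z<s)) (after (rightmostZero (β n)) r<i)
  k∸1+i≡m : k ∸ suc i ≡ m
  k∸1+i≡m = trans (cong (_∸ suc i) (trans (sym i+1+m≡k) (+-suc i m))) (m+n∸m≡n i m)

2*m+δ≡1+2*n⇒m≡n : ∀ {m n δ} → δ ≤ 2 → 2 * m + δ ≡ suc (2 * n) → m ≡ n
2*m+δ≡1+2*n⇒m≡n {m} {n} z≤n eq = ⊥-elim (even≢odd m n (trans (sym (+-identityʳ (2 * m))) eq))
2*m+δ≡1+2*n⇒m≡n {m} {n} (s≤s z≤n) eq =
  *-cancelˡ-≡ m n 2 (suc-injective (trans (+-comm 1 (2 * m)) eq))
2*m+δ≡1+2*n⇒m≡n {m} {n} (s≤s (s≤s z≤n)) eq =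
  ⊥-elim (even≢odd (suc m) n (trans (trans (*-suc 2 m) (+-comm 2 (2 * m))) eq))

m%2≡1⇒m≡1+2*[m/2] : ∀ {n} → n % 2 ≡ 1 → n ≡ suc (2 * (n / 2))
m%2≡1⇒m≡1+2*[m/2] {n} n%2≡1 =
  trans (m≡m%n+[m/n]*n n 2) (cong₂ _+_ n%2≡1 (*-comm (n / 2) 2))

s≡shiftR-after-principalPrefix : ∀ {n c} → IsHyperbinary n c → ∀ i m → principalLength n < i →
  i + m ≡ bitLength n → s i c ≡ shiftR n m
s≡shiftR-after-principalPrefix {n} {c} (|c|≡k , _ , value≡n) i zero _ i+0≡k =
  trans (s-beyond-length c (≤-reflexive (trans |c|≡k (trans (sym i+0≡k) (+-identityʳ i))))) value≡n
s≡shiftR-after-principalPrefix {n} {c} hc@(|c|≡k , digits≤2 , _) i (suc m) r<i i+1+m≡k =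
  2*m+δ≡1+2*n⇒m≡n (All.lookup digits≤2 (∈-lookup o)) (begin
    2 * s i c + lookup c o     ≡⟨ s-suc c i<|c| ⟨
    s (suc i) c                ≡⟨ s≡shiftR-after-principalPrefix hc (suc i) m (m<n⇒m<1+n r<i) 1+i+m≡k ⟩
    shiftR n m                 ≡⟨ m%2≡1⇒m≡1+2*[m/2] (odd-shiftR-after-principalPrefix n r<i i+1+m≡k) ⟩
    suc (2 * shiftR n (suc m)) ∎)
  where
  open ≡-Reasoning
  1+i+m≡k = trans (sym (+-suc i m)) i+1+m≡k
  i<|c| : i < length c
  i<|c| = subst (i <_) (trans i+1+m≡k (sym |c|≡k)) (m<m+n i z<s)
  o = fromℕ< i<|c|

s≡-after-principalPrefix : ∀ {n c d} → IsHyperbinary n c → IsHyperbinary n d →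
  ∀ {j} → principalLength n < j → s j c ≡ s j d
s≡-after-principalPrefix {n} {c} {d} hc@(|c|≡k , _ , value-c) hd@(|d|≡k , _ , value-d) {j} r<j
  with j ≤? bitLength n
... | yes j≤k = trans (s≡shiftR-after-principalPrefix hc j m r<j j+m≡k)
                      (sym (s≡shiftR-after-principalPrefix hd j m r<j j+m≡k))
  where
  m = bitLength n ∸ j
  j+m≡k = m+[n∸m]≡n j≤k
... | no  j≰k = begin
  s j c    ≡⟨ s-beyond-length c (≤-trans (≤-reflexive |c|≡k) k≤j) ⟩
  value c  ≡⟨ trans value-c (sym value-d) ⟩
  value d  ≡⟨ s-beyond-length d (≤-trans (≤-reflexive |d|≡k) k≤j) ⟨
  s j d    ∎
  where
  open ≡-Reasoning
  k≤j = <⇒≤ (≰⇒> j≰k)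

proposition3p6 : (n : ℕ) → 1 ≤ n → (c d : List ℕ) → IsHyperbinary n c → IsHyperbinary n d →
    ((c ≤ᴰ d → ((j : ℕ) → 1 ≤ j → j ≤ principalLength n → s j c ≤ s j d))
    × (((j : ℕ) → 1 ≤ j → j ≤ principalLength n → s j c ≤ s j d) → c ≤ᴰ d))
proposition3p6 n _ c d hc@(|c|≡k , _ , value-c) hd@(|d|≡k , _ , value-d) =
  (λ c≤d j _ _ → ≤ᴰ⇒s≤ |c|≡|d| c≤d j) ,
  (λ s≤ → s≤⇒≤ᴰ c d |c|≡|d| (everywhere s≤) (trans value-c (sym value-d)))
  where
  |c|≡|d| = trans |c|≡k (sym |d|≡k)
  everywhere : (∀ j → 1 ≤ j → j ≤ principalLength n → s j c ≤ s j d) → ∀ j → s j c ≤ s j d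
  everywhere _  zero    = z≤n
  everywhere s≤ (suc j) with suc j ≤? principalLength n
  ... | yes j≤r = s≤ (suc j) (s≤s z≤n) j≤r
  ... | no  j≰r = ≤-reflexive (s≡-after-principalPrefix hc hd (≰⇒> j≰r))
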